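{- Let $p$ be a prime with $p \equiv 1 \pmod 4$ and let $S \subseteq V(Pal_p) = \mathbb{F}_p$ be non-empty. Let $f_S(x) = \prod_{j \in S}(x - j)$. Then $$\left| \sum_{i=0}^{p-1} \chi_L\big(f_S(i)\big) \right| = \Big|\, |S \cup Odd(S)| - |S \cup Even(S)| \,\Big|,$$ where $Odd(S)$ and $Even(S)$ are taken in the Paley graph $Pal_p$.
   Context: For a prime $p \equiv 1 \pmod 4$, the Paley graph $Pal_p$ is the simple undirected graph with vertex set $\mathbb{F}_p$ in which distinct $i,j$ are adjacent iff $i-j$ is a nonzero square in $\mathbb{F}_p$. $\chi_L$ is the Legendre character on $\mathbb{F}_p$: $\chi_L(x) = x^{(p-1)/2} \bmod p$, viewed as an integer in $\{0,1,-1\}$ (so $\chi_L(0)=0$, $\chi_L(x)=1$ for nonzero squares, $\chi_L(x)=-1$ for non-squares). For a graph $G$ and $D \subseteq V(G)$, with $\mathcal{N}(v)$ the neighborhood of $v$: $Odd(D) = \{v \in V(G) : |\mathcal{N}(v)\cap D| \equiv 1 \pmod 2\}$ and $Even(D) = \{v \in V(G) : |\mathcal{N}(v)\cap D| \equiv 0 \pmod 2\}$. -}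

module Defs where

open import Data.Bool using (Bool; true; false; if_then_else_; _∧_; not)
open import Data.Nat using (ℕ; zero; suc; _+_; _*_; _∸_; _^_; _%_; _/_; _≡ᵇ_; NonZero)
open import Data.Nat.Properties using ()
open import Data.Fin using (Fin; toℕ)
open import Data.Fin.Subset using (Subset; inside; outside; _∈_)
open import Data.Fin.Subset.Properties using (_∈?_)
open import Data.Integer using (ℤ; +_; -_) renaming (_+_ to _+ℤ_)
open import Data.List using (List; foldr; map; allFin; filterᵇ; length)
open import Data.Bool.ListAction using (any)
open import Data.Vec using (tabulate)
open import Relation.Nullary using (does)

-- Elements of F_p are represented by Fin p; arithmetic is done on
-- representatives in ℕ reduced mod p.

subModP : (p : ℕ) .{{_ : NonZero p}} → ℕ → ℕ → ℕ
subModP p i j = (i + (p ∸ (j % p))) % p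

χL : (p : ℕ) .{{_ : NonZero p}} → ℕ → ℤ
χL p x with (x ^ ((p ∸ 1) / 2)) % p
... | r = if r ≡ᵇ 0 then + 0 else (if r ≡ᵇ 1 then + 1 else - (+ 1))

isNZSquare : (p : ℕ) .{{_ : NonZero p}} → ℕ → Bool
isNZSquare p d =
  not ((d % p) ≡ᵇ 0) ∧ any (λ (y : Fin p) → ((toℕ y * toℕ y) % p) ≡ᵇ (d % p)) (allFin p)

paleyAdj : (p : ℕ) .{{_ : NonZero p}} → Fin p → Fin p → Bool
paleyAdj p i j = not (toℕ i ≡ᵇ toℕ j) ∧ isNZSquare p (subModP p (toℕ i) (toℕ j))

nbrCount : (p : ℕ) .{{_ : NonZero p}} → Subset p → Fin p → ℕ
nbrCount p D v =
  length (filterᵇ (λ j → paleyAdj p v j ∧ does (j ∈? D)) (allFin p))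

isOdd : ℕ → Bool
isOdd n = (n % 2) ≡ᵇ 1

Odd : (p : ℕ) .{{_ : NonZero p}} → Subset p → Subset p
Odd p D = tabulate (λ v → if isOdd (nbrCount p D v) then inside else outside)

Even : (p : ℕ) .{{_ : NonZero p}} → Subset p → Subset p
Even p D = tabulate (λ v → if isOdd (nbrCount p D v) then outside else inside)

fS : (p : ℕ) .{{_ : NonZero p}} → Subset p → ℕ → ℕ
fS p S i =
  foldr (λ j acc → (subModP p i (toℕ j) * acc) % p) (1 % p)
        (filterᵇ (λ j → does (j ∈? S)) (allFin p))

charSum : (p : ℕ) .{{_ : NonZero p}} → Subset p → ℤ
charSum p S = foldr (λ (i : Fin p) acc → χL p (fS p S (toℕ i)) +ℤ acc) (+ 0) (allFin p)

module Submission where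

-- χL p x is x ^ ((p − 1) / 2) mod p read as a sign, so the heart of the matter is Euler's
-- criterion. Pairing every unit x with d / x shows that the product of all units is
-- d ^ ((p − 1) / 2) when d is a non-residue; when d = y², the same pairing on the units other
-- than ±y shows that it is − d ^ ((p − 1) / 2). With Wilson's theorem (the case y = 1) this
-- identifies χL with the Legendre symbol, which is therefore multiplicative, and
-- χL (f_S i) = ∏_{j ∈ S} χL (i − j). For i ∈ S this vanishes; for i ∉ S it is −1 to the
-- number of j ∈ S with i − j a non-residue, i.e. (−1)^|S| · (−1)^|N(i) ∩ S|. Summing over i
-- gives ± (|S ∪ Even S| − |S ∪ Odd S|).

open import Defs
open import Data.Nat using (ℕ; _%_; NonZero)
open import Data.Nat.Primality using (Prime)
open import Data.Fin.Subset using (Subset; Nonempty; _∪_; ∣_∣)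
open import Data.Integer using (+_; _-_) renaming (∣_∣ to abs)
open import Relation.Binary.PropositionalEquality using (_≡_)

open import Data.Bool.Base using (Bool; true; false; if_then_else_; _∧_; _∨_; _xor_; not; T)
open import Data.Bool.Properties
  using (∧-zeroʳ; ∧-identityʳ; T-≡; T-∧; T-not-≡; not-involutive; not-distribˡ-xor; not-distribʳ-xor)
open import Data.Empty using (⊥-elim)
open import Data.Fin.Base as Fin using (Fin; toℕ; fromℕ<)
open import Data.Fin.Properties using (toℕ<n; toℕ-fromℕ<; toℕ-injective)
open import Data.Fin.Subset using (inside; outside)
open import Data.Fin.Subset.Properties using (_∈?_)
open import Data.Integer.Base as ℤ using (ℤ; -_)
import Data.Integer.Properties as ℤ
open import Data.Integer.Tactic.RingSolver using () renaming (solve-∀ to ℤ-solve-∀)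
open import Data.List.Base as List using (List; []; _∷_; foldr; length; filterᵇ; allFin)
open import Data.List.Membership.Propositional using (_∈_; lose)
open import Data.List.Membership.Propositional.Properties using (∈-allFin; ∈-filter⁺)
open import Data.List.Relation.Unary.All as All using (All; []; _∷_)
open import Data.List.Relation.Unary.All.Properties using (all-filter)
open import Data.List.Relation.Unary.Any using (Any; here; there; satisfied)
open import Data.List.Relation.Unary.Any.Properties using (any⁺; any⁻)
open import Data.Nat.Base hiding (parity)
open import Data.Nat.Coprimality using (coprime-Bézout; prime⇒coprime)
open import Data.Nat.Divisibility using (_∣_; divides; m%n≡0⇒n∣m)
open import Data.Nat.DivMod
open import Data.Nat.GCD using (module Bézout)
open import Data.Nat.Primality using (euclidsLemma; prime⇒nonTrivial)
open import Data.Nat.Properties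
open import Data.Nat.Tactic.RingSolver using (solve-∀)
open import Data.Product using (∃-syntax; _×_; _,_)
open import Data.Sum using (_⊎_; inj₁; inj₂; [_,_])
open import Data.Unit using (tt)
open import Data.Vec.Base using ([]; _∷_; lookup)
open import Data.Vec.Functional using (Vector)
open import Data.Vec.Properties using (lookup-zipWith; lookup∘tabulate)
open import Function.Base using (id; _∘_; case_of_)
open import Function.Bundles using (Equivalence)
open import Level using (0ℓ)
open import Relation.Binary.Bundles using (Setoid)
import Relation.Binary.Construct.On as On
open import Relation.Binary.PropositionalEquality
  using (_≢_; refl; sym; trans; cong; cong₂; subst; module ≡-Reasoning)
import Relation.Binary.PropositionalEquality as ≡
import Relation.Binary.Reasoning.Setoid as SetoidReasoning
open import Relation.Nullary using (¬_; Dec; yes; no; does)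
open import Relation.Nullary.Decidable using (T?; dec-false)

open import Algebra.Properties.CommutativeSemigroup *-commutativeSemigroup
  using (xy∙z≈y∙xz) renaming (x∙yz≈y∙xz to *-lcomm)
open import Algebra.Properties.Semiring.Sum ℤ.+-*-semiring
  using (sum; sum-syntax; sum-cong-≗; *-distribˡ-sum)

-- Products and counts over {z < N ∣ P z}

infixl 5 _∖_

prodBelow : ℕ → (ℕ → Bool) → ℕ
prodBelow zero    P = 1
prodBelow (suc N) P = (if P N then N else 1) * prodBelow N P

countBelow : ℕ → (ℕ → Bool) → ℕ
countBelow zero    P = 0
countBelow (suc N) P = (if P N then 1 else 0) + countBelow N P

_∖_ : (ℕ → Bool) → ℕ → ℕ → Bool
(P ∖ x) z = P z ∧ not (z ≡ᵇ x)

module _ {P Q : ℕ → Bool} where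

  prodBelow-cong : ∀ N → (∀ {z} → z < N → P z ≡ Q z) → prodBelow N P ≡ prodBelow N Q
  prodBelow-cong zero    P≗Q = refl
  prodBelow-cong (suc N) P≗Q =
    cong₂ (λ b r → (if b then N else 1) * r) (P≗Q ≤-refl) (prodBelow-cong N (P≗Q ∘ m<n⇒m<1+n))

  countBelow-cong : ∀ N → (∀ {z} → z < N → P z ≡ Q z) → countBelow N P ≡ countBelow N Q
  countBelow-cong zero    P≗Q = refl
  countBelow-cong (suc N) P≗Q =
    cong₂ (λ b r → (if b then 1 else 0) + r) (P≗Q ≤-refl) (countBelow-cong N (P≗Q ∘ m<n⇒m<1+n))

module _ (P : ℕ → Bool) (x : ℕ) where

  ∖-self : (P ∖ x) x ≡ false
  ∖-self with x ≡ᵇ x | ≡⇒≡ᵇ x x refl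
  ... | true | _ = ∧-zeroʳ (P x)

  ∖-other : ∀ {z} → z ≢ x → (P ∖ x) z ≡ P z
  ∖-other {z} z≢x with z ≡ᵇ x | ≡ᵇ⇒≡ z x
  ... | false | _      = ∧-identityʳ (P z)
  ... | true  | z≡ᵇx⇒ = ⊥-elim (z≢x (z≡ᵇx⇒ tt))

  ∖-⊆ : ∀ {z} → (P ∖ x) z ≡ true → P z ≡ true
  ∖-⊆ {z} P∖xz with P z
  ... | true  = refl
  ... | false = P∖xz

  ∖-≢ : ∀ {z} → (P ∖ x) z ≡ true → z ≢ x
  ∖-≢ Pz refl = case trans (sym Pz) ∖-self of λ ()

  prodBelow-∖ : ∀ N → x < N → P x ≡ true → prodBelow N P ≡ x * prodBelow N (P ∖ x)
  prodBelow-∖ (suc N) x<1+N Px with x ≟ N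
  ... | yes refl rewrite ∖-self | Px = cong (x *_)
    (trans (prodBelow-cong N (λ z<N → sym (∖-other (<⇒≢ z<N)))) (sym (+-identityʳ _)))
  ... | no x≢N rewrite ∖-other {N} (x≢N ∘ sym) | prodBelow-∖ N (≤∧≢⇒< (s≤s⁻¹ x<1+N) x≢N) Px =
    *-lcomm (if P N then N else 1) x _

  countBelow-∖ : ∀ N → x < N → P x ≡ true → countBelow N P ≡ suc (countBelow N (P ∖ x))
  countBelow-∖ (suc N) x<1+N Px with x ≟ N
  ... | yes refl rewrite ∖-self | Px = cong suc (countBelow-cong N (λ z<N → sym (∖-other (<⇒≢ z<N))))
  ... | no x≢N rewrite ∖-other {N} (x≢N ∘ sym) | countBelow-∖ N (≤∧≢⇒< (s≤s⁻¹ x<1+N) x≢N) Px =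
    +-suc (if P N then 1 else 0) _

countBelow≡0⇒prodBelow≡1 : ∀ N P → countBelow N P ≡ 0 → prodBelow N P ≡ 1
countBelow≡0⇒prodBelow≡1 zero    P _ = refl
countBelow≡0⇒prodBelow≡1 (suc N) P count≡0 with P N
... | false = trans (+-identityʳ _) (countBelow≡0⇒prodBelow≡1 N P count≡0)

countBelow≢0⇒∃ : ∀ N P → countBelow N P ≢ 0 → ∃[ x ] x < N × P x ≡ true
countBelow≢0⇒∃ zero    P count≢0 = ⊥-elim (count≢0 refl)
countBelow≢0⇒∃ (suc N) P count≢0 with P N in PN
... | true  = N , ≤-refl , PN
... | false with countBelow≢0⇒∃ N P count≢0
...   | x , x<N , Px = x , m<n⇒m<1+n x<N , Px

module _ (P : ℕ → Bool) {x y : ℕ} (N : ℕ) (x<N : x < N) (y<N : y < N) (y≢x : y ≢ x)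
         (Px : P x ≡ true) (Py : P y ≡ true) where

  private
    [P∖x]y : (P ∖ x) y ≡ true
    [P∖x]y = trans (∖-other P x y≢x) Py

  countBelow-∖∖ : countBelow N P ≡ 2 + countBelow N (P ∖ x ∖ y)
  countBelow-∖∖ = trans (countBelow-∖ P x N x<N Px) (cong suc (countBelow-∖ (P ∖ x) y N y<N [P∖x]y))

  prodBelow-∖∖ : prodBelow N P ≡ x * y * prodBelow N (P ∖ x ∖ y)
  prodBelow-∖∖ = trans (prodBelow-∖ P x N x<N Px)
    (trans (cong (x *_) (prodBelow-∖ (P ∖ x) y N y<N [P∖x]y)) (sym (*-assoc x y _)))

nonzero : ℕ → Bool
nonzero z = not (z ≡ᵇ 0)

nonzero⇒≢0 : ∀ {z} → nonzero z ≡ true → z ≢ 0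
nonzero⇒≢0 {suc _} _ ()

≢0⇒nonzero : ∀ {z} → z ≢ 0 → nonzero z ≡ true
≢0⇒nonzero {zero}  z≢0 = ⊥-elim (z≢0 refl)
≢0⇒nonzero {suc _} _   = refl

countBelow-nonzero : ∀ N → countBelow N nonzero ≡ N ∸ 1
countBelow-nonzero zero          = refl
countBelow-nonzero (suc zero)    = refl
countBelow-nonzero (suc (suc N)) = cong suc (countBelow-nonzero (suc N))

-- Parities, signs and sums

parity : ℕ → Bool
parity zero    = false
parity (suc n) = not (parity n)

isOdd≡parity : ∀ n → isOdd n ≡ parity n
isOdd≡parity zero          = refl
isOdd≡parity (suc zero)    = refl
isOdd≡parity (suc (suc n)) = begin
  ((2 + n) % 2 ≡ᵇ 1)   ≡⟨ cong (λ r → r ≡ᵇ 1) (trans (cong (_% 2) (+-comm 2 n)) ([m+n]%n≡m%n n 2)) ⟩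
  isOdd n              ≡⟨ isOdd≡parity n ⟩
  parity n             ≡⟨ not-involutive (parity n) ⟨
  parity (2 + n)       ∎
  where open ≡-Reasoning

module _ {A : Set} where

  count : (A → Bool) → List A → ℕ
  count q xs = length (filterᵇ q xs)

  filterᵇ-∧ : ∀ (a s : A → Bool) xs → filterᵇ (λ x → a x ∧ s x) xs ≡ filterᵇ a (filterᵇ s xs)
  filterᵇ-∧ a s []       = refl
  filterᵇ-∧ a s (x ∷ xs) with a x in ax | s x
  ... | true  | true  rewrite ax = cong (x ∷_) (filterᵇ-∧ a s xs)
  ... | true  | false = filterᵇ-∧ a s xs
  ... | false | true  rewrite ax = filterᵇ-∧ a s xs
  ... | false | false = filterᵇ-∧ a s xs

  parity-count-not : ∀ (a : A → Bool) xs →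
    parity (count (not ∘ a) xs) ≡ parity (length xs) xor parity (count a xs)
  parity-count-not a []       = refl
  parity-count-not a (x ∷ xs) with a x
  ... | true  = begin
    parity (count (not ∘ a) xs)                                ≡⟨ parity-count-not a xs ⟩
    parity (length xs) xor parity (count a xs)                 ≡⟨ not-involutive _ ⟨
    not (not (parity (length xs) xor parity (count a xs)))     ≡⟨ cong not (not-distribʳ-xor (parity (length xs)) _) ⟩
    not (parity (length xs) xor not (parity (count a xs)))     ≡⟨ not-distribˡ-xor (parity (length xs)) _ ⟩
    not (parity (length xs)) xor not (parity (count a xs))     ∎
    where open ≡-Reasoning
  ... | false = trans (cong not (parity-count-not a xs)) (not-distribˡ-xor (parity (length xs)) _)

signᵇ : Bool → ℤ
signᵇ b = if b then - + 1 else + 1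

signᵇ-xor : ∀ a b → signᵇ (a xor b) ≡ signᵇ a ℤ.* signᵇ b
signᵇ-xor false false = refl
signᵇ-xor false true  = refl
signᵇ-xor true  false = refl
signᵇ-xor true  true  = refl

indicator : Bool → ℤ
indicator b = if b then + 1 else + 0

signᵇ≡indicator-difference : ∀ b →
  signᵇ b ≡ indicator (if b then outside else inside) ℤ.- indicator (if b then inside else outside)
signᵇ≡indicator-difference false = refl
signᵇ≡indicator-difference true  = refl

foldr-tabulate : ∀ {B : Set} {n} (f : B → ℤ) (g : Fin n → B) →
                 foldr (λ x acc → f x ℤ.+ acc) (+ 0) (List.tabulate g) ≡ sum (f ∘ g)
foldr-tabulate {n = zero}  f g = refl
foldr-tabulate {n = suc n} f g = cong (λ t → f (g Fin.zero) ℤ.+ t) (foldr-tabulate f (g ∘ Fin.suc))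

sum-sub : ∀ {n} (f g : Vector ℤ n) → sum (λ i → f i ℤ.- g i) ≡ sum f ℤ.- sum g
sum-sub {zero}  f g = refl
sum-sub {suc n} f g = trans (cong (λ t → (f Fin.zero ℤ.- g Fin.zero) ℤ.+ t) (sum-sub (f ∘ Fin.suc) (g ∘ Fin.suc)))
  (+-sub-interchange (f Fin.zero) (g Fin.zero) (sum (f ∘ Fin.suc)) (sum (g ∘ Fin.suc)))
  where
  +-sub-interchange : ∀ a b c d → (a ℤ.- b) ℤ.+ (c ℤ.- d) ≡ (a ℤ.+ c) ℤ.- (b ℤ.+ d)
  +-sub-interchange = ℤ-solve-∀

∣∣≡sum-indicator : ∀ {n} (v : Subset n) → + ∣ v ∣ ≡ sum (indicator ∘ lookup v)
∣∣≡sum-indicator []          = refl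
∣∣≡sum-indicator (true ∷ v)  = cong (λ t → + 1 ℤ.+ t) (∣∣≡sum-indicator v)
∣∣≡sum-indicator (false ∷ v) = trans (∣∣≡sum-indicator v) (sym (ℤ.+-identityˡ _))

module _ {A : Set} (f : A → ℤ) where

  ∏ : List A → ℤ
  ∏ = foldr (λ x acc → f x ℤ.* acc) (+ 1)

  ∏-zero : ∀ {xs} → Any (λ x → f x ≡ + 0) xs → ∏ xs ≡ + 0
  ∏-zero {x ∷ xs} (here fx≡0)  = trans (cong (ℤ._* ∏ xs) fx≡0) refl
  ∏-zero {x ∷ xs} (there any0) = trans (cong (f x ℤ.*_) (∏-zero any0)) (ℤ.*-zeroʳ (f x))

  ∏-signᵇ : ∀ (q : A → Bool) {xs} → All (λ x → f x ≡ signᵇ (q x)) xs → ∏ xs ≡ signᵇ (parity (count q xs))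
  ∏-signᵇ q {[]}     []                = refl
  ∏-signᵇ q {x ∷ xs} (fx≡±1 ∷ all±1) with q x
  ... | true  = begin
    f x ℤ.* ∏ xs                                 ≡⟨ cong₂ ℤ._*_ fx≡±1 (∏-signᵇ q all±1) ⟩
    signᵇ true ℤ.* signᵇ (parity (count q xs))   ≡⟨ signᵇ-xor true _ ⟨
    signᵇ (not (parity (count q xs)))            ∎
    where open ≡-Reasoning
  ... | false = trans (cong₂ ℤ._*_ fx≡±1 (∏-signᵇ q all±1)) (ℤ.*-identityˡ _)

abs-signᵇ : ∀ b → abs (signᵇ b) ≡ 1
abs-signᵇ false = refl
abs-signᵇ true  = refl

-- Arithmetic modulo p

^-distribʳ-* : ∀ a b k → (a * b) ^ k ≡ a ^ k * b ^ k
^-distribʳ-* a b zero    = refl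
^-distribʳ-* a b (suc k) = trans (cong ((a * b) *_) (^-distribʳ-* a b k)) (*-interchange a b (a ^ k) (b ^ k))
  where
  *-interchange : ∀ a b c d → a * b * (c * d) ≡ a * c * (b * d)
  *-interchange = solve-∀

m∣n⇒0<n<m+m⇒n≡m : ∀ {m n} → m ∣ n → 0 < n → n < m + m → n ≡ m
m∣n⇒0<n<m+m⇒n≡m {m} (divides zero          refl) ()
m∣n⇒0<n<m+m⇒n≡m {m} (divides (suc zero)    refl) _ _ = +-identityʳ m
m∣n⇒0<n<m+m⇒n≡m {m} (divides (suc (suc q)) refl) _ n<m+m =
  ⊥-elim (<⇒≱ n<m+m (+-monoʳ-≤ m (m≤m+n m (q * m))))

m∣n+[m∸k]⇒n≡k : ∀ {m n k} → n < m → k < m → m ∣ n + (m ∸ k) → n ≡ k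
m∣n+[m∸k]⇒n≡k {m} {n} {k} n<m k<m m∣n+[m∸k] = +-cancelʳ-≡ (m ∸ k) n k (begin
  n + (m ∸ k)   ≡⟨ m∣n⇒0<n<m+m⇒n≡m m∣n+[m∸k] 0<n+[m∸k] (+-mono-<-≤ n<m (m∸n≤m m k)) ⟩
  m             ≡⟨ m+[n∸m]≡n (<⇒≤ k<m) ⟨
  k + (m ∸ k)   ∎)
  where
  open ≡-Reasoning
  0<n+[m∸k] : 0 < n + (m ∸ k)
  0<n+[m∸k] = <-≤-trans (m<n⇒0<n∸m k<m) (m≤n+m (m ∸ k) n)

module Congruence (p : ℕ) .{{_ : NonZero p}} where

  infix 4 _≈_
  _≈_ : ℕ → ℕ → Set
  a ≈ b = a % p ≡ b % p

  ≈-setoid : Setoid 0ℓ 0ℓ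
  ≈-setoid = On.setoid (≡.setoid ℕ) (_% p)

  module ≈-Reasoning = SetoidReasoning ≈-setoid

  ≡⇒≈ : ∀ {a b} → a ≡ b → a ≈ b
  ≡⇒≈ = cong (_% p)

  %-≈ : ∀ a → a % p ≈ a
  %-≈ a = m%n%n≡m%n a p

  +-cong : ∀ {a a′ b b′} → a ≈ a′ → b ≈ b′ → a + b ≈ a′ + b′
  +-cong {a} {a′} {b} {b′} a≈a′ b≈b′ = begin
    (a + b) % p               ≡⟨ %-distribˡ-+ a b p ⟩
    (a % p + b % p) % p       ≡⟨ cong₂ (λ u v → (u + v) % p) a≈a′ b≈b′ ⟩
    (a′ % p + b′ % p) % p     ≡⟨ %-distribˡ-+ a′ b′ p ⟨
    (a′ + b′) % p             ∎
    where open ≡-Reasoning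

  *-cong : ∀ {a a′ b b′} → a ≈ a′ → b ≈ b′ → a * b ≈ a′ * b′
  *-cong {a} {a′} {b} {b′} a≈a′ b≈b′ = begin
    (a * b) % p               ≡⟨ %-distribˡ-* a b p ⟩
    (a % p * (b % p)) % p     ≡⟨ cong₂ (λ u v → (u * v) % p) a≈a′ b≈b′ ⟩
    (a′ % p * (b′ % p)) % p   ≡⟨ %-distribˡ-* a′ b′ p ⟨
    (a′ * b′) % p             ∎
    where open ≡-Reasoning

  ^-congˡ : ∀ {a b} k → a ≈ b → a ^ k ≈ b ^ k
  ^-congˡ zero    a≈b = refl
  ^-congˡ (suc k) a≈b = *-cong a≈b (^-congˡ k a≈b)

  0<p : 0 < p
  0<p = >-nonZero⁻¹ p

  0%p≡0 : 0 % p ≡ 0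
  0%p≡0 = m<n⇒m%n≡m 0<p

  ≈⇒≡ : ∀ {a b} → a < p → b < p → a ≈ b → a ≡ b
  ≈⇒≡ a<p b<p a≈b = trans (sym (m<n⇒m%n≡m a<p)) (trans a≈b (m<n⇒m%n≡m b<p))

  *p≈0 : ∀ k → k * p ≈ 0
  *p≈0 k = trans (m*n%n≡0 k p) (sym 0%p≡0)

  p≈0 : p ≈ 0
  p≈0 = trans (n%n≡0 p) (sym 0%p≡0)

  negate-inverse : ∀ a → (p ∸ a % p) + a ≈ 0
  negate-inverse a = begin
    (p ∸ a % p) + a      ≈⟨ +-cong {p ∸ a % p} refl (%-≈ a) ⟨
    (p ∸ a % p) + a % p  ≡⟨ m∸n+n≡m (m%n≤n a p) ⟩
    p                    ≈⟨ p≈0 ⟩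
    0                    ∎
    where open ≈-Reasoning

  +-cancelˡ : ∀ a {b c} → a + b ≈ a + c → b ≈ c
  +-cancelˡ a {b} {c} a+b≈a+c = begin
    b                       ≈⟨ +-cong (negate-inverse a) (refl {x = b % p}) ⟨
    ((p ∸ a % p) + a) + b   ≡⟨ +-assoc (p ∸ a % p) a b ⟩
    (p ∸ a % p) + (a + b)   ≈⟨ +-cong {p ∸ a % p} refl a+b≈a+c ⟩
    (p ∸ a % p) + (a + c)   ≡⟨ +-assoc (p ∸ a % p) a c ⟨
    ((p ∸ a % p) + a) + c   ≈⟨ +-cong (negate-inverse a) (refl {x = c % p}) ⟩
    c                       ∎
    where open ≈-Reasoning

  +-inverse-unique : ∀ {a b} c → a + c ≈ 0 → b + c ≈ 0 → a ≈ b
  +-inverse-unique {a} {b} c a+c≈0 b+c≈0 =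
    +-cancelˡ c (trans (≡⇒≈ (+-comm c a)) (trans a+c≈0 (sym (trans (≡⇒≈ (+-comm c b)) b+c≈0))))

  suc[p∸1]≡p : suc (p ∸ 1) ≡ p
  suc[p∸1]≡p = trans (+-comm 1 (p ∸ 1)) (m∸n+n≡m 0<p)

  [p∸1]*a+a≈0 : ∀ a → (p ∸ 1) * a + a ≈ 0
  [p∸1]*a+a≈0 a = begin
    (p ∸ 1) * a + a   ≡⟨ +-comm ((p ∸ 1) * a) a ⟩
    suc (p ∸ 1) * a   ≡⟨ cong (_* a) suc[p∸1]≡p ⟩
    p * a             ≡⟨ *-comm p a ⟩
    a * p             ≈⟨ *p≈0 a ⟩
    0                 ∎
    where open ≈-Reasoning

  *-negate : ∀ a {b} → b ≤ p → a * (p ∸ b) ≈ (p ∸ 1) * (a * b)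
  *-negate a {b} b≤p = +-inverse-unique (a * b) a[p∸b]+ab≈0 ([p∸1]*a+a≈0 (a * b))
    where
    a[p∸b]+ab≈0 : a * (p ∸ b) + a * b ≈ 0
    a[p∸b]+ab≈0 = begin
      a * (p ∸ b) + a * b   ≡⟨ *-distribˡ-+ a (p ∸ b) b ⟨
      a * (p ∸ b + b)       ≡⟨ cong (a *_) (m∸n+n≡m b≤p) ⟩
      a * p                 ≈⟨ *p≈0 a ⟩
      0                     ∎
      where open ≈-Reasoning

  [p∸1]*[p∸1]≈1 : (p ∸ 1) * (p ∸ 1) ≈ 1
  [p∸1]*[p∸1]≈1 = +-inverse-unique (p ∸ 1) ([p∸1]*a+a≈0 (p ∸ 1)) (trans (≡⇒≈ suc[p∸1]≡p) p≈0)

  negate-square : ∀ {y} → y ≤ p → (p ∸ y) * (p ∸ y) ≈ y * y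
  negate-square {y} y≤p = begin
    (p ∸ y) * (p ∸ y)               ≈⟨ *-negate (p ∸ y) y≤p ⟩
    (p ∸ 1) * ((p ∸ y) * y)         ≡⟨ cong ((p ∸ 1) *_) (*-comm (p ∸ y) y) ⟩
    (p ∸ 1) * (y * (p ∸ y))         ≈⟨ *-cong {p ∸ 1} refl (*-negate y y≤p) ⟩
    (p ∸ 1) * ((p ∸ 1) * (y * y))   ≡⟨ *-assoc (p ∸ 1) (p ∸ 1) (y * y) ⟨
    (p ∸ 1) * (p ∸ 1) * (y * y)     ≈⟨ *-cong [p∸1]*[p∸1]≈1 (refl {x = (y * y) % p}) ⟩
    1 * (y * y)                     ≡⟨ *-identityˡ (y * y) ⟩
    y * y                           ∎
    where open ≈-Reasoning

  %p≢0 : ∀ {x} → x < p → x ≢ 0 → x % p ≢ 0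
  %p≢0 x<p x≢0 x%p≡0 = x≢0 (trans (sym (m<n⇒m%n≡m x<p)) x%p≡0)

  subModP-self : ∀ i → subModP p i i % p ≡ 0
  subModP-self i = begin
    subModP p i i % p        ≡⟨ %-≈ (i + (p ∸ i % p)) ⟩
    (i + (p ∸ i % p)) % p    ≡⟨ cong (_% p) (+-comm i (p ∸ i % p)) ⟩
    ((p ∸ i % p) + i) % p    ≡⟨ negate-inverse i ⟩
    0 % p                    ≡⟨ 0%p≡0 ⟩
    0                        ∎
    where open ≡-Reasoning

  subModP-%p≢0 : ∀ {i j} → i < p → j < p → i ≢ j → subModP p i j % p ≢ 0
  subModP-%p≢0 {i} {j} i<p j<p i≢j [i-j]%p≡0 = i≢j (m∣n+[m∸k]⇒n≡k i<p j<p (m%n≡0⇒n∣m _ p (begin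
    (i + (p ∸ j)) % p         ≡⟨ cong (λ t → (i + (p ∸ t)) % p) (m<n⇒m%n≡m j<p) ⟨
    (i + (p ∸ j % p)) % p     ≡⟨ %-≈ (i + (p ∸ j % p)) ⟨
    subModP p i j % p         ≡⟨ [i-j]%p≡0 ⟩
    0                         ∎)))
    where open ≡-Reasoning

module Pairing (p : ℕ) .{{_ : NonZero p}} (N c : ℕ) where

  open Congruence p

  HasPartners : (ℕ → Bool) → Set
  HasPartners P = ∀ {x} → x < N → P x ≡ true → ∃[ y ] y < N × P y ≡ true × y ≢ x × x * y ≈ c

  PartnersUnique : (ℕ → Bool) → Set
  PartnersUnique P = ∀ {x y y′} → x < N → y < N → y′ < N → P x ≡ true → x * y ≈ c → x * y′ ≈ c → y ≡ y′

  Matching : (ℕ → Bool) → Set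
  Matching P = HasPartners P × PartnersUnique P

  remove-pair : ∀ P → countBelow N P ≢ 0 → Matching P →
    ∃[ P′ ] countBelow N P ≡ 2 + countBelow N P′ × prodBelow N P ≈ c * prodBelow N P′ × Matching P′
  remove-pair P count≢0 (partners , unique) with countBelow≢0⇒∃ N P count≢0
  ... | x , x<N , Px with partners x<N Px
  ... | y , y<N , Py , y≢x , xy≈c = P ∖ x ∖ y , countBelow-∖∖ P N x<N y<N y≢x Px Py , product , partners′ , unique′
    where
    ⊆P : ∀ {z} → (P ∖ x ∖ y) z ≡ true → P z ≡ true
    ⊆P = ∖-⊆ P x ∘ ∖-⊆ (P ∖ x) y

    product : prodBelow N P ≈ c * prodBelow N (P ∖ x ∖ y)
    product = trans (≡⇒≈ (prodBelow-∖∖ P N x<N y<N y≢x Px Py)) (*-cong xy≈c refl)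

    partners′ : HasPartners (P ∖ x ∖ y)
    partners′ {z} z<N P′z with partners z<N (⊆P P′z)
    ... | w , w<N , Pw , w≢z , zw≈c = w , w<N , P′w , w≢z , zw≈c
      where
      z≢y : z ≢ y
      z≢y = ∖-≢ (P ∖ x) y P′z
      z≢x : z ≢ x
      z≢x = ∖-≢ P x (∖-⊆ (P ∖ x) y P′z)
      w≢x : w ≢ x
      w≢x refl = z≢y (unique x<N z<N y<N Px (trans (≡⇒≈ (*-comm w z)) zw≈c) xy≈c)
      w≢y : w ≢ y
      w≢y refl = z≢x (unique y<N z<N x<N Py (trans (≡⇒≈ (*-comm w z)) zw≈c) (trans (≡⇒≈ (*-comm w x)) xy≈c))
      P′w : (P ∖ x ∖ y) w ≡ true
      P′w = trans (∖-other (P ∖ x) y w≢y) (trans (∖-other P x w≢x) Pw)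

    unique′ : PartnersUnique (P ∖ x ∖ y)
    unique′ x<N y<N y′<N P′x = unique x<N y<N y′<N (⊆P P′x)

  pairing : ∀ P n → countBelow N P ≡ n → Matching P → ∃[ k ] n ≡ 2 * k × prodBelow N P ≈ c ^ k
  pairing P zero count≡0 _ = 0 , refl , ≡⇒≈ (countBelow≡0⇒prodBelow≡1 N P count≡0)
  pairing P (suc n) count≡1+n matching with remove-pair P (λ count≡0 → 1+n≢0 (trans (sym count≡1+n) count≡0)) matching
  pairing P (suc zero)    count≡1 _ | _ , count≡2+_ , _ = case trans (sym count≡1) count≡2+_ of λ ()
  pairing P (suc (suc n)) count≡2+n _ | P′ , count≡2+P′ , product , matching′
    with pairing P′ n (suc-injective (suc-injective (trans (sym count≡2+P′) count≡2+n))) matching′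
  ... | k , n≡2k , product′ = suc k , trans (cong (suc ∘ suc) n≡2k) (sym (*-distribˡ-+ 2 1 k)) ,
    trans product (*-cong {c} refl product′)

module PrimeModulus (p : ℕ) .{{_ : NonZero p}} (p-prime : Prime p) where

  open Congruence p

  inverse : ∀ {a} → a % p ≢ 0 → ∃[ b ] a * b ≈ 1
  inverse {a} a%p≢0 with coprime-Bézout (prime⇒coprime p-prime {{≢-nonZero a%p≢0}} (m%n<n a p))
  ... | Bézout.-+ x y eq = y , (begin
    a * y            ≈⟨ *-cong (%-≈ a) (refl {x = y % p}) ⟨
    a % p * y        ≡⟨ *-comm (a % p) y ⟩
    y * (a % p)      ≡⟨ eq ⟨
    1 + x * p        ≈⟨ +-cong {1} refl (*p≈0 x) ⟩
    1                ∎)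
    where open ≈-Reasoning
  ... | Bézout.+- x y eq = (p ∸ 1) * y , (begin
    a * ((p ∸ 1) * y)         ≡⟨ *-lcomm a (p ∸ 1) y ⟩
    (p ∸ 1) * (a * y)         ≈⟨ *-cong {p ∸ 1} refl ay≈p∸1 ⟩
    (p ∸ 1) * (p ∸ 1)         ≈⟨ [p∸1]*[p∸1]≈1 ⟩
    1                         ∎)
    where
    open ≈-Reasoning
    ay+1≈0 : a * y + 1 ≈ 0
    ay+1≈0 = begin
      a * y + 1        ≈⟨ +-cong (*-cong (%-≈ a) (refl {x = y % p})) (refl {x = 1 % p}) ⟨
      a % p * y + 1    ≡⟨ trans (+-comm _ 1) (cong suc (*-comm (a % p) y)) ⟩
      1 + y * (a % p)  ≡⟨ eq ⟩
      x * p            ≈⟨ *p≈0 x ⟩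
      0                ∎
    ay≈p∸1 : a * y ≈ p ∸ 1
    ay≈p∸1 = +-inverse-unique 1 ay+1≈0 (trans (≡⇒≈ (m∸n+n≡m 0<p)) p≈0)

  *-cancelˡ : ∀ a {b c} → a % p ≢ 0 → a * b ≈ a * c → b ≈ c
  *-cancelˡ a {b} {c} a%p≢0 ab≈ac with inverse a%p≢0
  ... | i , ai≈1 = begin
    b              ≡⟨ *-identityˡ b ⟨
    1 * b          ≈⟨ *-cong ai≈1 (refl {x = b % p}) ⟨
    (a * i) * b    ≡⟨ xy∙z≈y∙xz a i b ⟩
    i * (a * b)    ≈⟨ *-cong {i} refl ab≈ac ⟩
    i * (a * c)    ≡⟨ xy∙z≈y∙xz a i c ⟨
    (a * i) * c    ≈⟨ *-cong ai≈1 (refl {x = c % p}) ⟩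
    1 * c          ≡⟨ *-identityˡ c ⟩
    c              ∎
    where open ≈-Reasoning

  square-root : ∀ {x y} → x < p → 0 < y → y < p → x * x ≈ y * y → x ≡ y ⊎ x ≡ p ∸ y
  square-root {x} {y} x<p 0<y y<p x²≈y² with euclidsLemma (x + y) (x + (p ∸ y)) p-prime p∣product
    where
    y+[p∸y]≡p : y + (p ∸ y) ≡ p
    y+[p∸y]≡p = m+[n∸m]≡n (<⇒≤ y<p)
    product≈0 : (x + y) * (x + (p ∸ y)) ≈ 0
    product≈0 = +-cancelˡ (y * y) (begin
      y * y + (x + y) * (x + (p ∸ y))   ≡⟨ difference-of-squares x y (p ∸ y) ⟩
      x * x + (x + y) * (y + (p ∸ y))   ≡⟨ cong (λ t → x * x + (x + y) * t) y+[p∸y]≡p ⟩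
      x * x + (x + y) * p               ≈⟨ +-cong x²≈y² (*p≈0 (x + y)) ⟩
      y * y + 0                         ∎)
      where
      open ≈-Reasoning
      difference-of-squares : ∀ x y t → y * y + (x + y) * (x + t) ≡ x * x + (x + y) * (y + t)
      difference-of-squares = solve-∀
    p∣product : p ∣ (x + y) * (x + (p ∸ y))
    p∣product = m%n≡0⇒n∣m _ p (trans product≈0 0%p≡0)
  ... | inj₁ p∣x+y = inj₂ (trans (sym (m+n∸n≡m x y))
    (cong (_∸ y) (m∣n⇒0<n<m+m⇒n≡m p∣x+y (<-≤-trans 0<y (m≤n+m y x)) (+-mono-< x<p y<p))))
  ... | inj₂ p∣x+[p∸y] = inj₁ (m∣n+[m∸k]⇒n≡k x<p y<p p∣x+[p∸y])

  *-%p≢0 : ∀ {a b} → a % p ≢ 0 → b % p ≢ 0 → (a * b) % p ≢ 0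
  *-%p≢0 {a} {b} a%p≢0 b%p≢0 ab%p≡0 =
    b%p≢0 (trans (*-cancelˡ a a%p≢0 (trans ab%p≡0 (sym (trans (≡⇒≈ (*-zeroʳ a)) 0%p≡0)))) 0%p≡0)

  factor-unique : ∀ {z v} → z < p → v < p → v ≢ 0 → z * v ≈ v * v → z ≡ v
  factor-unique {z} {v} z<p v<p v≢0 zv≈vv =
    ≈⇒≡ z<p v<p (*-cancelˡ v (%p≢0 v<p v≢0) (trans (≡⇒≈ (*-comm v z)) zv≈vv))

  quotient : ∀ {d x} → d % p ≢ 0 → x < p → x ≢ 0 → ∃[ y ] y < p × y ≢ 0 × x * y ≈ d
  quotient {d} {x} d%p≢0 x<p x≢0 with inverse (%p≢0 x<p x≢0)
  ... | i , xi≈1 = (d * i) % p , m%n<n (d * i) p , y≢0 , xy≈d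
    where
    open ≈-Reasoning
    xy≈d : x * ((d * i) % p) ≈ d
    xy≈d = begin
      x * ((d * i) % p)   ≈⟨ *-cong {x} refl (%-≈ (d * i)) ⟩
      x * (d * i)         ≡⟨ *-lcomm x d i ⟩
      d * (x * i)         ≈⟨ *-cong {d} refl xi≈1 ⟩
      d * 1               ≡⟨ *-identityʳ d ⟩
      d                   ∎
    y≢0 : (d * i) % p ≢ 0
    y≢0 y≡0 = d%p≢0 (trans (begin
      d                   ≈⟨ xy≈d ⟨
      x * ((d * i) % p)   ≡⟨ cong (x *_) y≡0 ⟩
      x * 0               ≡⟨ *-zeroʳ x ⟩
      0                   ∎) 0%p≡0)

  open Pairing p p using (PartnersUnique)

  partnersUnique : ∀ {P c} → (∀ {z} → P z ≡ true → z ≢ 0) → PartnersUnique c P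
  partnersUnique P⊆nonzero x<p y<p y′<p Px xy≈c xy′≈c =
    ≈⇒≡ y<p y′<p (*-cancelˡ _ (%p≢0 x<p (P⊆nonzero Px)) (trans xy≈c (sym xy′≈c)))

-- Euler's criterion and the Legendre symbol

module EulerCriterion (p : ℕ) .{{_ : NonZero p}} (p-prime : Prime p) (p-odd : p % 2 ≡ 1) where

  open Congruence p
  open PrimeModulus p p-prime
  open Pairing p p using (pairing)

  m : ℕ
  m = (p ∸ 1) / 2

  2≢p : 2 ≢ p
  2≢p refl = case p-odd of λ ()

  1<p : 1 < p
  1<p = nonTrivial⇒n>1 p {{prime⇒nonTrivial p-prime}}

  2<p : 2 < p
  2<p = ≤∧≢⇒< 1<p 2≢p

  p∸1<p : p ∸ 1 < p
  p∸1<p = ∸-monoʳ-< {p} {1} {0} z<s (<⇒≤ 1<p)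

  p∸1%p≢0 : (p ∸ 1) % p ≢ 0
  p∸1%p≢0 = %p≢0 p∸1<p (≢-nonZero⁻¹ (p ∸ 1) {{≢-nonZero (m>n⇒m∸n≢0 1<p)}})

  m≡half : ∀ {k} → p ∸ 1 ≡ 2 * k → m ≡ k
  m≡half {k} p∸1≡2k = trans (cong (_/ 2) (trans p∸1≡2k (*-comm 2 k))) (m*n/n≡m k 2)

  y≢p∸y : ∀ {y} → y < p → y ≢ p ∸ y
  y≢p∸y {y} y<p y≡p∸y = case trans (sym p-odd) (trans (cong (_% 2) p≡y*2) (m*n%n≡0 y 2)) of λ ()
    where
    y+y≡y*2 : y + y ≡ y * 2
    y+y≡y*2 = trans (cong (λ t → y + t) (sym (+-identityʳ y))) (*-comm 2 y)
    p≡y*2 : p ≡ y * 2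
    p≡y*2 = trans (sym (m+[n∸m]≡n (<⇒≤ y<p))) (trans (cong (λ t → y + t) (sym y≡p∸y)) y+y≡y*2)

  unitsProduct : ℕ
  unitsProduct = prodBelow p nonzero

  unitsProduct-nonsquare : ∀ {d} → d % p ≢ 0 → (∀ {z} → z < p → ¬ z * z ≈ d) → unitsProduct ≈ d ^ m
  unitsProduct-nonsquare {d} d%p≢0 nonsquare =
    conclude (pairing d nonzero (p ∸ 1) (countBelow-nonzero p) (partners , partnersUnique nonzero⇒≢0))
    where
    partners : ∀ {x} → x < p → nonzero x ≡ true → ∃[ y ] y < p × nonzero y ≡ true × y ≢ x × x * y ≈ d
    partners {x} x<p nonzero-x = partner (quotient d%p≢0 x<p (nonzero⇒≢0 nonzero-x))
      where
      partner : (∃[ y ] y < p × y ≢ 0 × x * y ≈ d) → ∃[ y ] y < p × nonzero y ≡ true × y ≢ x × x * y ≈ d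
      partner (y , y<p , y≢0 , xy≈d) = y , y<p , ≢0⇒nonzero y≢0 , (λ { refl → nonsquare y<p xy≈d }) , xy≈d
    conclude : (∃[ k ] p ∸ 1 ≡ 2 * k × unitsProduct ≈ d ^ k) → unitsProduct ≈ d ^ m
    conclude (k , p∸1≡2k , product≈d^k) = trans product≈d^k (≡⇒≈ (cong (d ^_) (sym (m≡half {k} p∸1≡2k))))

  -- The units other than ±y pair off under x ↦ y² / x, and y · (p − y) ≈ −y².
  unitsProduct-square : ∀ {y} → 0 < y → y < p → unitsProduct ≈ (p ∸ 1) * (y * y) ^ m
  unitsProduct-square {y} 0<y y<p =
    conclude (pairing (y * y) P (countBelow p P) refl (partners , partnersUnique (λ {z} → nonzero⇒≢0 ∘ ⊆nonzero {z})))
    where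
    y≢0 : y ≢ 0
    y≢0 = ≢-nonZero⁻¹ y {{>-nonZero 0<y}}
    y′ : ℕ
    y′ = p ∸ y
    y′<p : y′ < p
    y′<p = ∸-monoʳ-< 0<y (<⇒≤ y<p)
    y′≢0 : y′ ≢ 0
    y′≢0 = m>n⇒m∸n≢0 y<p
    y′≢y : y′ ≢ y
    y′≢y = y≢p∸y y<p ∘ sym
    y²%p≢0 : (y * y) % p ≢ 0
    y²%p≢0 = *-%p≢0 (%p≢0 y<p y≢0) (%p≢0 y<p y≢0)
    P : ℕ → Bool
    P = nonzero ∖ y ∖ y′
    ⊆nonzero : ∀ {z} → P z ≡ true → nonzero z ≡ true
    ⊆nonzero {z} = ∖-⊆ nonzero y {z} ∘ ∖-⊆ (nonzero ∖ y) y′ {z}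
    partners : ∀ {z} → z < p → P z ≡ true → ∃[ w ] w < p × P w ≡ true × w ≢ z × z * w ≈ y * y
    partners {z} z<p Pz = partner (quotient y²%p≢0 z<p (nonzero⇒≢0 (⊆nonzero {z} Pz)))
      where
      z≢y′ : z ≢ y′
      z≢y′ = ∖-≢ (nonzero ∖ y) y′ {z} Pz
      z≢y : z ≢ y
      z≢y = ∖-≢ nonzero y {z} (∖-⊆ (nonzero ∖ y) y′ {z} Pz)
      partner : (∃[ w ] w < p × w ≢ 0 × z * w ≈ y * y) → ∃[ w ] w < p × P w ≡ true × w ≢ z × z * w ≈ y * y
      partner (w , w<p , w≢0 , zw≈yy) = w , w<p , Pw , w≢z , zw≈yy
        where
        w≢z : w ≢ z
        w≢z refl = [ z≢y , z≢y′ ] (square-root z<p 0<y y<p zw≈yy)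
        w≢y : w ≢ y
        w≢y refl = z≢y (factor-unique z<p y<p y≢0 zw≈yy)
        w≢y′ : w ≢ y′
        w≢y′ refl = z≢y′ (factor-unique z<p y′<p y′≢0 (trans zw≈yy (sym (negate-square (<⇒≤ y<p)))))
        Pw : P w ≡ true
        Pw = trans (∖-other (nonzero ∖ y) y′ w≢y′) (trans (∖-other nonzero y w≢y) (≢0⇒nonzero w≢0))
    conclude : (∃[ k ] countBelow p P ≡ 2 * k × prodBelow p P ≈ (y * y) ^ k) → unitsProduct ≈ (p ∸ 1) * (y * y) ^ m
    conclude (k , countP≡2k , prodP≈yy^k) = begin
      unitsProduct                         ≡⟨ prodBelow-∖∖ nonzero p y<p y′<p y′≢y (≢0⇒nonzero y≢0) (≢0⇒nonzero y′≢0) ⟩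
      y * y′ * prodBelow p P               ≈⟨ *-cong (*-negate y (<⇒≤ y<p)) prodP≈yy^k ⟩
      (p ∸ 1) * (y * y) * (y * y) ^ k      ≡⟨ *-assoc (p ∸ 1) (y * y) _ ⟩
      (p ∸ 1) * (y * y) ^ suc k            ≡⟨ cong (λ e → (p ∸ 1) * (y * y) ^ e) (sym (m≡half {suc k} p∸1≡2[1+k])) ⟩
      (p ∸ 1) * (y * y) ^ m                ∎
      where
      open ≈-Reasoning
      p∸1≡2[1+k] : p ∸ 1 ≡ 2 * suc k
      p∸1≡2[1+k] = trans (sym (countBelow-nonzero p))
        (trans (countBelow-∖∖ nonzero p y<p y′<p y′≢y (≢0⇒nonzero y≢0) (≢0⇒nonzero y′≢0))
        (trans (cong (suc ∘ suc) countP≡2k) (sym (*-distribˡ-+ 2 1 k))))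

  wilson : unitsProduct ≈ p ∸ 1
  wilson = trans (unitsProduct-square z<s 1<p) (≡⇒≈ (trans (cong ((p ∸ 1) *_) (^-zeroˡ m)) (*-identityʳ (p ∸ 1))))

  0<m : 0 < m
  0<m = m≥n⇒m/n>0 (∸-monoˡ-≤ 1 2<p)

  euler-zero : ∀ {d} → d % p ≡ 0 → (d ^ m) % p ≡ 0
  euler-zero {d} d%p≡0 = trans (^-zero m 0<m) 0%p≡0
    where
    ^-zero : ∀ k → 0 < k → d ^ k ≈ 0
    ^-zero (suc k) _ = *-cong (trans d%p≡0 (sym 0%p≡0)) (refl {x = (d ^ k) % p})

  isNZSquare⇒square : ∀ {d} → isNZSquare p d ≡ true → d % p ≢ 0 × ∃[ y ] y < p × y * y ≈ d
  isNZSquare⇒square {d} isSquare with Equivalence.to T-∧ (Equivalence.from T-≡ isSquare)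
  ... | d%p≢0 , hasRoot with satisfied (any⁻ _ (allFin p) hasRoot)
  ...   | y , y²≡ᵇd =
    (λ d%p≡0 → subst (λ r → T (not (r ≡ᵇ 0))) d%p≡0 d%p≢0) , toℕ y , toℕ<n y , ≡ᵇ⇒≡ _ _ y²≡ᵇd

  square⇒isNZSquare : ∀ {d y} → d % p ≢ 0 → y < p → y * y ≈ d → isNZSquare p d ≡ true
  square⇒isNZSquare {d} {y} d%p≢0 y<p y²≈d = Equivalence.to T-≡ (Equivalence.from T-∧
    ( Equivalence.from T-not-≡ (dec-false (d % p ≟ 0) d%p≢0)
    , any⁺ _ (lose (∈-allFin (fromℕ< y<p)) (≡⇒≡ᵇ _ _ (subst (λ t → t * t ≈ d) (sym (toℕ-fromℕ< y<p)) y²≈d)))))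

  square^m≈1 : ∀ {y} → 0 < y → y < p → (y * y) ^ m ≈ 1
  square^m≈1 0<y y<p = *-cancelˡ (p ∸ 1) p∸1%p≢0
    (trans (sym (unitsProduct-square 0<y y<p)) (trans wilson (≡⇒≈ (sym (*-identityʳ (p ∸ 1))))))

  euler-square : ∀ {d} → isNZSquare p d ≡ true → (d ^ m) % p ≡ 1
  euler-square {d} isSquare with isNZSquare⇒square isSquare
  ... | d%p≢0 , y , y<p , y²≈d = trans (trans (^-congˡ m (sym y²≈d)) (square^m≈1 0<y y<p)) (m<n⇒m%n≡m 1<p)
    where
    0<y : 0 < y
    0<y = n≢0⇒n>0 (λ { refl → d%p≢0 (trans (sym y²≈d) 0%p≡0) })

  euler-nonsquare : ∀ {d} → d % p ≢ 0 → isNZSquare p d ≡ false → (d ^ m) % p ≡ p ∸ 1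
  euler-nonsquare {d} d%p≢0 notSquare =
    trans (trans (sym (unitsProduct-nonsquare d%p≢0 noRoot)) wilson) (m<n⇒m%n≡m p∸1<p)
    where
    noRoot : ∀ {z} → z < p → ¬ z * z ≈ d
    noRoot z<p z²≈d = case trans (sym (square⇒isNZSquare d%p≢0 z<p z²≈d)) notSquare of λ ()

-- χL p x unfolds to residueSign ((x ^ ((p ∸ 1) / 2)) % p).
residueSign : ℕ → ℤ
residueSign r = if r ≡ᵇ 0 then + 0 else (if r ≡ᵇ 1 then + 1 else - + 1)

module LegendreSymbol (p : ℕ) .{{_ : NonZero p}} (p-prime : Prime p) (p-odd : p % 2 ≡ 1) where

  open Congruence p
  open EulerCriterion p p-prime p-odd

  residueSign-p∸1 : residueSign (p ∸ 1) ≡ - + 1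
  residueSign-p∸1 = cong residueSign (sym (m+[n∸m]≡n (∸-monoˡ-≤ 1 2<p)))

  χL-zero : ∀ {d} → d % p ≡ 0 → χL p d ≡ + 0
  χL-zero d%p≡0 = cong residueSign (euler-zero d%p≡0)

  χL-square : ∀ {d} → isNZSquare p d ≡ true → χL p d ≡ + 1
  χL-square isSquare = cong residueSign (euler-square isSquare)

  χL-nonsquare : ∀ {d} → d % p ≢ 0 → isNZSquare p d ≡ false → χL p d ≡ - + 1
  χL-nonsquare d%p≢0 notSquare = trans (cong residueSign (euler-nonsquare d%p≢0 notSquare)) residueSign-p∸1

  data PowerResidue : ℕ → Set where
    zero      : PowerResidue 0
    one       : PowerResidue 1
    minus-one : PowerResidue (p ∸ 1)

  powerResidue : ∀ d → PowerResidue ((d ^ m) % p)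
  powerResidue d = classify (d % p ≟ 0) (isNZSquare p d) refl
    where
    classify : Dec (d % p ≡ 0) → (b : Bool) → isNZSquare p d ≡ b → PowerResidue ((d ^ m) % p)
    classify (yes d%p≡0) _     _         = subst PowerResidue (sym (euler-zero d%p≡0)) zero
    classify (no d%p≢0)  true  isSquare  = subst PowerResidue (sym (euler-square isSquare)) one
    classify (no d%p≢0)  false notSquare = subst PowerResidue (sym (euler-nonsquare d%p≢0 notSquare)) minus-one

  residueSign-* : ∀ {r s} → PowerResidue r → PowerResidue s →
                  residueSign ((r * s) % p) ≡ residueSign r ℤ.* residueSign s
  residueSign-* zero      _         = cong residueSign 0%p≡0
  residueSign-* one       zero      = cong residueSign 0%p≡0
  residueSign-* one       one       = cong residueSign (m<n⇒m%n≡m 1<p)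
  residueSign-* one       minus-one = begin
    residueSign ((1 * (p ∸ 1)) % p)   ≡⟨ cong residueSign (trans (≡⇒≈ (*-identityˡ (p ∸ 1))) (m<n⇒m%n≡m p∸1<p)) ⟩
    residueSign (p ∸ 1)               ≡⟨ ℤ.*-identityˡ _ ⟨
    + 1 ℤ.* residueSign (p ∸ 1)       ∎
    where open ≡-Reasoning
  residueSign-* minus-one zero      = begin
    residueSign (((p ∸ 1) * 0) % p)   ≡⟨ cong residueSign (trans (≡⇒≈ (*-zeroʳ (p ∸ 1))) 0%p≡0) ⟩
    + 0                               ≡⟨ ℤ.*-zeroʳ (residueSign (p ∸ 1)) ⟨
    residueSign (p ∸ 1) ℤ.* + 0       ∎
    where open ≡-Reasoning
  residueSign-* minus-one one       = begin
    residueSign (((p ∸ 1) * 1) % p)   ≡⟨ cong residueSign (trans (≡⇒≈ (*-identityʳ (p ∸ 1))) (m<n⇒m%n≡m p∸1<p)) ⟩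
    residueSign (p ∸ 1)               ≡⟨ ℤ.*-identityʳ _ ⟨
    residueSign (p ∸ 1) ℤ.* + 1       ∎
    where open ≡-Reasoning
  residueSign-* minus-one minus-one = begin
    residueSign (((p ∸ 1) * (p ∸ 1)) % p)       ≡⟨ cong residueSign (trans [p∸1]*[p∸1]≈1 (m<n⇒m%n≡m 1<p)) ⟩
    + 1                                         ≡⟨ cong₂ ℤ._*_ residueSign-p∸1 residueSign-p∸1 ⟨
    residueSign (p ∸ 1) ℤ.* residueSign (p ∸ 1) ∎
    where open ≡-Reasoning

  χL-* : ∀ a b → χL p (a * b) ≡ χL p a ℤ.* χL p b
  χL-* a b = begin
    residueSign (((a * b) ^ m) % p)                  ≡⟨ cong residueSign (≡⇒≈ (^-distribʳ-* a b m)) ⟩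
    residueSign ((a ^ m * b ^ m) % p)                ≡⟨ cong residueSign (%-distribˡ-* (a ^ m) (b ^ m) p) ⟩
    residueSign (((a ^ m) % p * ((b ^ m) % p)) % p)  ≡⟨ residueSign-* (powerResidue a) (powerResidue b) ⟩
    residueSign ((a ^ m) % p) ℤ.* residueSign ((b ^ m) % p) ∎
    where open ≡-Reasoning

  χL-% : ∀ a → χL p (a % p) ≡ χL p a
  χL-% a = cong residueSign (^-congˡ m (%-≈ a))

  χL-1%p : χL p (1 % p) ≡ + 1
  χL-1%p = trans (χL-% 1) (cong residueSign (trans (≡⇒≈ (^-zeroˡ m)) (m<n⇒m%n≡m 1<p)))

  χL-foldr : ∀ {A : Set} (g : A → ℕ) xs →
             χL p (foldr (λ x acc → (g x * acc) % p) (1 % p) xs) ≡ ∏ (χL p ∘ g) xs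
  χL-foldr g []       = χL-1%p
  χL-foldr g (x ∷ xs) = begin
    χL p ((g x * acc) % p)         ≡⟨ χL-% (g x * acc) ⟩
    χL p (g x * acc)               ≡⟨ χL-* (g x) acc ⟩
    χL p (g x) ℤ.* χL p acc        ≡⟨ cong (χL p (g x) ℤ.*_) (χL-foldr g xs) ⟩
    χL p (g x) ℤ.* ∏ (χL p ∘ g) xs ∎
    where
    open ≡-Reasoning
    acc : ℕ
    acc = foldr (λ x acc → (g x * acc) % p) (1 % p) xs

-- The Paley graph

∈?⇒lookup : ∀ {n} (S : Subset n) i → does (i ∈? S) ≡ lookup S i
∈?⇒lookup (true  ∷ S) Fin.zero    = refl
∈?⇒lookup (false ∷ S) Fin.zero    = refl
∈?⇒lookup (_     ∷ S) (Fin.suc i) = ∈?⇒lookup S i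

module PaleyGraph (p : ℕ) .{{_ : NonZero p}} (p-prime : Prime p) (p-odd : p % 2 ≡ 1) where

  open Congruence p
  open EulerCriterion p p-prime p-odd
  open LegendreSymbol p p-prime p-odd

  members : Subset p → List (Fin p)
  members S = filterᵇ (λ j → does (j ∈? S)) (allFin p)

  ∈-members : ∀ {S i} → lookup S i ≡ true → i ∈ members S
  ∈-members {S} {i} i∈S = ∈-filter⁺ (T? ∘ λ j → does (j ∈? S)) (∈-allFin i)
    (Equivalence.from T-≡ (trans (∈?⇒lookup S i) i∈S))

  members⊆ : ∀ S → All (λ j → lookup S j ≡ true) (members S)
  members⊆ S = All.map (λ {j} T[j∈S] → trans (sym (∈?⇒lookup S j)) (Equivalence.to T-≡ T[j∈S]))
    (all-filter (T? ∘ λ j → does (j ∈? S)) (allFin p))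

  paleyAdj-≢ : ∀ {i j} → toℕ i ≢ toℕ j → paleyAdj p i j ≡ isNZSquare p (subModP p (toℕ i) (toℕ j))
  paleyAdj-≢ {i} {j} i≢j = cong (λ b → not b ∧ isNZSquare p (subModP p (toℕ i) (toℕ j))) (dec-false (toℕ i ≟ toℕ j) i≢j)

  χL-difference : ∀ {i j : Fin p} → toℕ i ≢ toℕ j →
                  χL p (subModP p (toℕ i) (toℕ j)) ≡ signᵇ (not (paleyAdj p i j))
  χL-difference {i} {j} i≢j = trans (classify (isNZSquare p d) refl) (cong (signᵇ ∘ not) (sym (paleyAdj-≢ i≢j)))
    where
    d : ℕ
    d = subModP p (toℕ i) (toℕ j)
    classify : ∀ b → isNZSquare p d ≡ b → χL p d ≡ signᵇ (not b)
    classify true  isSquare  = χL-square isSquare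
    classify false notSquare = χL-nonsquare (subModP-%p≢0 (toℕ<n i) (toℕ<n j) i≢j) notSquare

  ε : Subset p → ℤ
  ε S = signᵇ (parity (length (members S)))

  parity-count-adjacent : ∀ S i → parity (count (paleyAdj p i) (members S)) ≡ isOdd (nbrCount p S i)
  parity-count-adjacent S i = sym (trans (isOdd≡parity (nbrCount p S i))
    (cong (parity ∘ length) (filterᵇ-∧ (paleyAdj p i) (λ j → does (j ∈? S)) (allFin p))))

  χL-fS-member : ∀ {S i} → lookup S i ≡ true → χL p (fS p S (toℕ i)) ≡ + 0
  χL-fS-member {S} {i} i∈S = trans (χL-foldr (subModP p (toℕ i) ∘ toℕ) (members S))
    (∏-zero (χL p ∘ subModP p (toℕ i) ∘ toℕ) (lose (∈-members i∈S) (χL-zero (subModP-self (toℕ i)))))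

  χL-fS-nonmember : ∀ {S i} → lookup S i ≡ false →
                    χL p (fS p S (toℕ i)) ≡ ε S ℤ.* signᵇ (isOdd (nbrCount p S i))
  χL-fS-nonmember {S} {i} i∉S = begin
    χL p (fS p S (toℕ i))                                          ≡⟨ χL-foldr (subModP p (toℕ i) ∘ toℕ) (members S) ⟩
    ∏ (χL p ∘ subModP p (toℕ i) ∘ toℕ) (members S)                 ≡⟨ ∏-signᵇ (χL p ∘ subModP p (toℕ i) ∘ toℕ) (not ∘ paleyAdj p i) (All.map χL-member (members⊆ S)) ⟩
    signᵇ (parity (count (not ∘ paleyAdj p i) (members S)))        ≡⟨ cong signᵇ (parity-count-not (paleyAdj p i) (members S)) ⟩
    signᵇ (parity (length (members S)) xor parity (count (paleyAdj p i) (members S)))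
                                                                   ≡⟨ cong (λ o → signᵇ (parity (length (members S)) xor o)) (parity-count-adjacent S i) ⟩
    signᵇ (parity (length (members S)) xor isOdd (nbrCount p S i)) ≡⟨ signᵇ-xor (parity (length (members S))) (isOdd (nbrCount p S i)) ⟩
    ε S ℤ.* signᵇ (isOdd (nbrCount p S i))                         ∎
    where
    open ≡-Reasoning
    χL-member : ∀ {j} → lookup S j ≡ true → χL p (subModP p (toℕ i) (toℕ j)) ≡ signᵇ (not (paleyAdj p i j))
    χL-member {j} j∈S = χL-difference λ i≡j → case trans (sym i∉S) (subst (λ k → lookup S k ≡ true) (sym (toℕ-injective i≡j)) j∈S) of λ ()

  lookup-∪-Odd : ∀ S i → lookup (S ∪ Odd p S) i ≡ lookup S i ∨ (if isOdd (nbrCount p S i) then inside else outside)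
  lookup-∪-Odd S i = trans (lookup-zipWith _∨_ i S (Odd p S)) (cong (lookup S i ∨_) (lookup∘tabulate _ i))

  lookup-∪-Even : ∀ S i → lookup (S ∪ Even p S) i ≡ lookup S i ∨ (if isOdd (nbrCount p S i) then outside else inside)
  lookup-∪-Even S i = trans (lookup-zipWith _∨_ i S (Even p S)) (cong (lookup S i ∨_) (lookup∘tabulate _ i))

  χL-fS : ∀ S i → χL p (fS p S (toℕ i)) ≡ ε S ℤ.* (indicator (lookup (S ∪ Even p S) i) ℤ.- indicator (lookup (S ∪ Odd p S) i))
  χL-fS S i rewrite lookup-∪-Odd S i | lookup-∪-Even S i = by-membership (lookup S i) refl
    where
    o : Bool
    o = isOdd (nbrCount p S i)
    by-membership : ∀ b → lookup S i ≡ b → χL p (fS p S (toℕ i)) ≡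
      ε S ℤ.* (indicator (b ∨ (if o then outside else inside)) ℤ.- indicator (b ∨ (if o then inside else outside)))
    by-membership true  i∈S = trans (χL-fS-member i∈S) (sym (ℤ.*-zeroʳ (ε S)))
    by-membership false i∉S = trans (χL-fS-nonmember i∉S) (cong (ε S ℤ.*_) (signᵇ≡indicator-difference o))

  charSum≡ε*difference : ∀ S → charSum p S ≡ ε S ℤ.* (+ ∣ S ∪ Even p S ∣ ℤ.- + ∣ S ∪ Odd p S ∣)
  charSum≡ε*difference S = begin
    charSum p S                                             ≡⟨ foldr-tabulate {n = p} (λ i → χL p (fS p S (toℕ i))) id ⟩
    ∑[ i < p ] (χL p (fS p S (toℕ i)))                       ≡⟨ sum-cong-≗ (χL-fS S) ⟩
    ∑[ i < p ] (ε S ℤ.* (inEven i ℤ.- inOdd i))              ≡⟨ *-distribˡ-sum (ε S) (λ i → inEven i ℤ.- inOdd i) ⟨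
    ε S ℤ.* ∑[ i < p ] (inEven i ℤ.- inOdd i)                ≡⟨ cong (ε S ℤ.*_) (sum-sub inEven inOdd) ⟩
    ε S ℤ.* (sum inEven ℤ.- sum inOdd)                      ≡⟨ cong₂ (λ e o → ε S ℤ.* (e ℤ.- o)) (∣∣≡sum-indicator (S ∪ Even p S)) (∣∣≡sum-indicator (S ∪ Odd p S)) ⟨
    ε S ℤ.* (+ ∣ S ∪ Even p S ∣ ℤ.- + ∣ S ∪ Odd p S ∣)      ∎
    where
    open ≡-Reasoning
    inEven inOdd : Vector ℤ p
    inEven = indicator ∘ lookup (S ∪ Even p S)
    inOdd  = indicator ∘ lookup (S ∪ Odd p S)

p%4≡1⇒p%2≡1 : ∀ {p} → p % 4 ≡ 1 → p % 2 ≡ 1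
p%4≡1⇒p%2≡1 {p} p%4≡1 = trans (sym (m∣n⇒o%n%m≡o%m 2 4 p (divides 2 refl))) (cong (_% 2) p%4≡1)

lemma1 : (p : ℕ) .{{_ : NonZero p}} → Prime p → p % 4 ≡ 1 →
    (S : Subset p) → Nonempty S →
    abs (charSum p S) ≡ abs (+ ∣ S ∪ Odd p S ∣ - + ∣ S ∪ Even p S ∣)
lemma1 p p-prime p%4≡1 S _ = begin
  abs (charSum p S)                 ≡⟨ cong abs (charSum≡ε*difference S) ⟩
  abs (ε S ℤ.* (|Even| - |Odd|))    ≡⟨ ℤ.abs-* (ε S) (|Even| - |Odd|) ⟩
  abs (ε S) * abs (|Even| - |Odd|)  ≡⟨ cong (_* abs (|Even| - |Odd|)) (abs-signᵇ (parity (length (members S)))) ⟩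
  1 * abs (|Even| - |Odd|)          ≡⟨ *-identityˡ _ ⟩
  abs (|Even| - |Odd|)              ≡⟨ ℤ.∣i-j∣≡∣j-i∣ |Even| |Odd| ⟩
  abs (|Odd| - |Even|)              ∎
  where
  open ≡-Reasoning
  open PaleyGraph p p-prime (p%4≡1⇒p%2≡1 {p} p%4≡1)
  |Odd| |Even| : ℤ
  |Odd|  = + ∣ S ∪ Odd p S ∣
  |Even| = + ∣ S ∪ Even p S ∣
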